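{- Let $k\ge 1$ and let $p$ be either $1$ or a prime. Then, as formal power series in $q$, $$\sum_{n\ge 0} a_{p,k}(n)\,q^n=\frac{q^{p+k-1}}{(1-q)^{k-1}(1-q^p)\,(q;q)_\infty}.$$
   Context: A partition of $n$ is a weakly decreasing finite sequence of positive integers summing to $n$; $\mathcal P(n)$ is the set of partitions of $n$ (the empty partition being the unique partition of $0$). For a partition $\lambda$ and positive integer $i$, $m_\lambda(i)$ is the number of parts equal to $i$. For $\lambda=(\lambda_1,\ldots,\lambda_\ell)$ with $\ell\ge k$, $\mathrm{pre}_k(\lambda)$ is the partition whose parts are the $\binom{\ell}{k}$ products $\lambda_{i_1}\cdots\lambda_{i_k}$ over all $1\le i_1<\cdots<i_k\le\ell$ (with multiplicity); it is undefined if $\ell<k$. $\mathrm{pre}_k(\mathcal P(n))$ is the set of $\mathrm{pre}_k(\lambda)$ for $\lambda\in\mathcal P(n)$ with at least $k$ parts, and $a_{i,k}(n)=\sum_{\nu\in\mathrm{pre}_k(\mathcal P(n))} m_\nu(i)$. Also $(q;q)_\infty=\prod_{j\ge1}(1-q^j)$. -}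

module Defs where

open import Data.Nat as ℕ using (ℕ; zero; suc; _∸_; _≤?_)
open import Data.Integer as ℤ using (ℤ; +_; -_; 0ℤ; 1ℤ)
open import Data.List using (List; []; _∷_; map; _++_; concatMap; length; filter; foldr)
open import Data.Nat.Base using (_⊓_)
open import Data.Bool using (if_then_else_)

-- ps fuel m n : all weakly decreasing lists of positive integers with
-- every part ≤ m and summing to n (fuel ≥ n suffices; parts are listed
-- largest first).
ps : ℕ → ℕ → ℕ → List (List ℕ)
ps _        _ zero    = [] ∷ []
ps zero     _ (suc _) = []
ps (suc f)  m (suc n) = concatMap (λ j → map (j ∷_) (ps f j (suc n ∸ j))) (range (m ⊓ suc n))
  where
  range : ℕ → List ℕ
  range zero    = []
  range (suc t) = suc t ∷ range t

partitions : ℕ → List (List ℕ)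
partitions n = ps n n n

-- all k-element sub-multisets chosen by position (i₁ < … < i_k)
subsOf : {A : Set} → ℕ → List A → List (List A)
subsOf zero    _        = [] ∷ []
subsOf (suc k) []       = []
subsOf (suc k) (x ∷ xs) = map (x ∷_) (subsOf k xs) ++ subsOf (suc k) xs

listProduct : List ℕ → ℕ
listProduct = foldr ℕ._*_ 1

-- pre_k(λ) as a multiset of parts (list, order irrelevant)
pre : ℕ → List ℕ → List ℕ
pre k λ′ = map listProduct (subsOf k λ′)

mult : List ℕ → ℕ → ℕ
mult ν i = length (filter (ℕ._≟ i) ν)

listSum : List ℕ → ℕ
listSum = foldr ℕ._+_ 0

a : ℕ → ℕ → ℕ → ℕ
a i k n = listSum (map (λ λ′ → mult (pre k λ′) i)
                       (filter (λ λ′ → k ≤? length λ′) (partitions n)))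

Series : Set
Series = ℕ → ℤ

sumTo : ℕ → (ℕ → ℤ) → ℤ
sumTo zero    f = f 0
sumTo (suc n) f = sumTo n f ℤ.+ f (suc n)

_⊛_ : Series → Series → Series
(f ⊛ g) n = sumTo n (λ i → f i ℤ.* g (n ∸ i))
infixl 7 _⊛_

oneS : Series
oneS zero    = 1ℤ
oneS (suc _) = 0ℤ

qPow : ℕ → Series
qPow m n = if m ℕ.≡ᵇ n then 1ℤ else 0ℤ

oneMinusQ : ℕ → Series
oneMinusQ j n = oneS n ℤ.- qPow j n

_^S_ : Series → ℕ → Series
f ^S zero  = oneS
f ^S suc e = f ⊛ (f ^S e)

finPoch : ℕ → Series
finPoch zero    = oneS
finPoch (suc t) = finPoch t ⊛ oneMinusQ (suc t)

-- (q;q)_∞ : its n-th coefficient equals that of ∏_{j=1}^{n}(1-q^j),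
-- since the factors with j > n do not affect coefficients of degree ≤ n.
qPochInf : Series
qPochInf n = finPoch n n

aSeries : ℕ → ℕ → Series
aSeries i k n = + a i k n

-- Write T_w^(m) = Σ_λ w(λ) q^|λ| over the partitions λ with all parts ≤ m; Σ_n a_{p,k}(n) qⁿ agrees
-- with T_w^(m), for w(λ) = m_{pre_k(λ)}(p), in all degrees ≤ m. Splitting off the parts
-- equal to m + 1 gives T_w^(m+1) = T_w^(m) + q^(m+1) T_{w(m+1 ∷ -)}^(m+1). Since p is irreducible,
-- a part j ∉ {1, p} occurs in no k-product equal to p, so w ignores it, T^(j) (1 - q^j) = T^(j-1),
-- and the cleared series T^(m) (q;q)_m is independent of m ≥ p. A part equal to p occurs exactly
-- in the k-products equal to p whose other factors are all 1, while parts below p never multiply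
-- to p; hence (1 - q^p) T_{k,p}^(p) (q;q)_p = q^p T_{k-1,1}^(p) (q;q)_p. For p = 1 this recursion
-- in k gives (1 - q)^k T_{k,1}^(1) (q;q)_1 = q^k, and the two together give the product formula
-- with (q;q)_m in place of (q;q)_∞, which agrees with it in degrees ≤ m.

module Submission where

open import Defs
open import Data.Nat using (ℕ; _+_; _∸_; _≤_)
open import Data.Nat.Primality using (Prime)
open import Data.Sum using (_⊎_)
open import Relation.Binary.PropositionalEquality using (_≡_)

open import Level using (0ℓ)
open import Function using (_∘_)
open import Data.Empty using (⊥-elim)
open import Data.Product using (_,_)
open import Data.Sum using (inj₁; inj₂; [_,_]′)
open import Data.Nat
  using (zero; suc; _*_; _<_; z≤n; s≤s; _≤′_; ≤′-refl; ≤′-step; _≟_; _≤?_; NonZero)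
import Data.Nat.Properties as ℕ
open import Data.Nat.Divisibility using (_∣_; m∣m*n)
open import Data.Nat.Primality
  using (Irreducible; irreducible[1]; ¬irreducible[0]; prime⇒irreducible)
open import Data.Nat.ListAction.Properties using (sum-++)
open import Data.Integer using (ℤ; +_; 0ℤ; 1ℤ)
  renaming (_+_ to _+ℤ_; _*_ to _*ℤ_; _-_ to _-ℤ_)
import Data.Integer.Properties as ℤ
open import Data.Integer.Tactic.RingSolver using (solve-∀)
open import Data.List using (List; []; _∷_; map; _++_; length; filter)
import Data.List.Properties as List
open import Data.List.Relation.Unary.All as All using (All; []; _∷_)
open import Data.List.Relation.Unary.All.Properties using (++⁺; map⁺)
open import Algebra.Bundles using (CommutativeMonoid)
open import Relation.Nullary using (yes; no; ¬_)
open import Relation.Unary using (Pred; Decidable)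
open import Relation.Binary.Bundles using (Setoid)
import Relation.Binary.Reasoning.Setoid
open import Relation.Binary.PropositionalEquality
  using (_≗_; _≢_; refl; sym; trans; cong; cong₂; subst; _→-setoid_; module ≡-Reasoning)

-- Finite sums

sumTo-cong : ∀ n {f g : ℕ → ℤ} → (∀ i → i ≤ n → f i ≡ g i) → sumTo n f ≡ sumTo n g
sumTo-cong zero    f≡g = f≡g 0 z≤n
sumTo-cong (suc n) f≡g =
  cong₂ _+ℤ_ (sumTo-cong n (λ i i≤n → f≡g i (ℕ.m≤n⇒m≤1+n i≤n))) (f≡g (suc n) ℕ.≤-refl)

sumTo-suc : ∀ n (f : ℕ → ℤ) → sumTo (suc n) f ≡ f 0 +ℤ sumTo n (f ∘ suc)
sumTo-suc zero    f = refl
sumTo-suc (suc n) f = trans (cong (_+ℤ f (suc (suc n))) (sumTo-suc n f)) (ℤ.+-assoc (f 0) _ _)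

sumTo-reverse : ∀ n (f : ℕ → ℤ) → sumTo n f ≡ sumTo n (λ i → f (n ∸ i))
sumTo-reverse zero    f = refl
sumTo-reverse (suc n) f = begin
  sumTo n f +ℤ f (suc n)                   ≡⟨ cong (_+ℤ f (suc n)) (sumTo-reverse n f) ⟩
  sumTo n (λ i → f (n ∸ i)) +ℤ f (suc n)   ≡⟨ ℤ.+-comm _ (f (suc n)) ⟩
  f (suc n) +ℤ sumTo n (λ i → f (n ∸ i))   ≡⟨ sumTo-suc n (λ i → f (suc n ∸ i)) ⟨
  sumTo (suc n) (λ i → f (suc n ∸ i))      ∎
  where open ≡-Reasoning

sumTo-+ : ∀ n (f g : ℕ → ℤ) → sumTo n (λ i → f i +ℤ g i) ≡ sumTo n f +ℤ sumTo n g
sumTo-+ zero    f g = refl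
sumTo-+ (suc n) f g =
  trans (cong (_+ℤ (f (suc n) +ℤ g (suc n))) (sumTo-+ n f g))
    (interchange (sumTo n f) (sumTo n g) (f (suc n)) (g (suc n)))
  where open import Algebra.Properties.CommutativeSemigroup ℤ.+-commutativeSemigroup using (interchange)

sumTo-minus : ∀ n (f g : ℕ → ℤ) → sumTo n (λ i → f i -ℤ g i) ≡ sumTo n f -ℤ sumTo n g
sumTo-minus zero    f g = refl
sumTo-minus (suc n) f g =
  trans (cong (_+ℤ (f (suc n) -ℤ g (suc n))) (sumTo-minus n f g))
    (regroup (sumTo n f) (sumTo n g) (f (suc n)) (g (suc n)))
  where
  regroup : ∀ a b c d → (a -ℤ b) +ℤ (c -ℤ d) ≡ (a +ℤ c) -ℤ (b +ℤ d)
  regroup = solve-∀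

sumTo-*ˡ : ∀ n c (f : ℕ → ℤ) → sumTo n (λ i → c *ℤ f i) ≡ c *ℤ sumTo n f
sumTo-*ˡ zero    c f = refl
sumTo-*ˡ (suc n) c f =
  trans (cong (_+ℤ c *ℤ f (suc n)) (sumTo-*ˡ n c f)) (sym (ℤ.*-distribˡ-+ c (sumTo n f) (f (suc n))))

sumTo-*ʳ : ∀ n c (f : ℕ → ℤ) → sumTo n (λ i → f i *ℤ c) ≡ sumTo n f *ℤ c
sumTo-*ʳ zero    c f = refl
sumTo-*ʳ (suc n) c f =
  trans (cong (_+ℤ f (suc n) *ℤ c) (sumTo-*ʳ n c f)) (sym (ℤ.*-distribʳ-+ c (sumTo n f) (f (suc n))))

sumTo-0 : ∀ n (f : ℕ → ℤ) → (∀ i → f i ≡ 0ℤ) → sumTo n f ≡ 0ℤ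
sumTo-0 zero    f f≡0 = f≡0 0
sumTo-0 (suc n) f f≡0 = cong₂ _+ℤ_ (sumTo-0 n f f≡0) (f≡0 (suc n))

sumTo-exchange : ∀ n (F : ℕ → ℕ → ℤ) →
  sumTo n (λ i → sumTo i (F i)) ≡ sumTo n (λ j → sumTo (n ∸ j) (λ t → F (j + t) j))
sumTo-exchange zero    F = refl
sumTo-exchange (suc n) F = begin
  sumTo n (λ i → sumTo i (F i)) +ℤ (sumTo n (F (suc n)) +ℤ F (suc n) (suc n))
    ≡⟨ cong (_+ℤ (sumTo n (F (suc n)) +ℤ F (suc n) (suc n))) (sumTo-exchange n F) ⟩
  sumTo n (λ j → inner (n ∸ j) j) +ℤ (sumTo n (F (suc n)) +ℤ F (suc n) (suc n))
    ≡⟨ ℤ.+-assoc (sumTo n (λ j → inner (n ∸ j) j)) (sumTo n (F (suc n))) (F (suc n) (suc n)) ⟨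
  (sumTo n (λ j → inner (n ∸ j) j) +ℤ sumTo n (F (suc n))) +ℤ F (suc n) (suc n)
    ≡⟨ cong (_+ℤ F (suc n) (suc n)) (sumTo-+ n (λ j → inner (n ∸ j) j) (F (suc n))) ⟨
  sumTo n (λ j → inner (n ∸ j) j +ℤ F (suc n) j) +ℤ F (suc n) (suc n)
    ≡⟨ cong₂ _+ℤ_ (sumTo-cong n extend) last ⟨
  sumTo n (λ j → inner (suc n ∸ j) j) +ℤ inner (suc n ∸ suc n) (suc n) ∎
  where
  open ≡-Reasoning
  inner : ℕ → ℕ → ℤ
  inner b j = sumTo b (λ t → F (j + t) j)
  extend : ∀ j → j ≤ n → inner (suc n ∸ j) j ≡ inner (n ∸ j) j +ℤ F (suc n) j
  extend j j≤n rewrite ℕ.+-∸-assoc 1 j≤n =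
    cong (λ i → inner (n ∸ j) j +ℤ F i j) (trans (ℕ.+-suc j (n ∸ j)) (cong suc (ℕ.m+[n∸m]≡n j≤n)))
  last : inner (suc n ∸ suc n) (suc n) ≡ F (suc n) (suc n)
  last rewrite ℕ.n∸n≡0 n = cong (λ i → F i (suc n)) (ℕ.+-identityʳ (suc n))

-- Formal power series

infix 4 _≗[_]_

_≗[_]_ : Series → ℕ → Series → Set
f ≗[ n ] g = ∀ i → i ≤ n → f i ≡ g i

⊛-cong-≤ : ∀ {n} {f f′ g g′ : Series} → f ≗[ n ] f′ → g ≗[ n ] g′ → f ⊛ g ≗[ n ] f′ ⊛ g′
⊛-cong-≤ f≗f′ g≗g′ i i≤n = sumTo-cong i λ j j≤i →
  cong₂ _*ℤ_ (f≗f′ j (ℕ.≤-trans j≤i i≤n)) (g≗g′ (i ∸ j) (ℕ.≤-trans (ℕ.m∸n≤m i j) i≤n))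

⊛-cong : ∀ {f f′ g g′ : Series} → f ≗ f′ → g ≗ g′ → f ⊛ g ≗ f′ ⊛ g′
⊛-cong f≗f′ g≗g′ n = ⊛-cong-≤ (λ i _ → f≗f′ i) (λ i _ → g≗g′ i) n ℕ.≤-refl

⊛-congˡ : ∀ {f f′} g → f ≗ f′ → f ⊛ g ≗ f′ ⊛ g
⊛-congˡ g f≗f′ = ⊛-cong f≗f′ (λ n → refl {x = g n})

⊛-congʳ : ∀ f {g g′} → g ≗ g′ → f ⊛ g ≗ f ⊛ g′
⊛-congʳ f g≗g′ = ⊛-cong (λ n → refl {x = f n}) g≗g′

⊛-comm : ∀ f g → f ⊛ g ≗ g ⊛ f
⊛-comm f g n = trans (sumTo-reverse n _) (sumTo-cong n λ i i≤n →
  trans (cong (λ j → f (n ∸ i) *ℤ g j) (ℕ.m∸[m∸n]≡n i≤n)) (ℤ.*-comm (f (n ∸ i)) (g i)))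

⊛-assoc : ∀ f g h → (f ⊛ g) ⊛ h ≗ f ⊛ (g ⊛ h)
⊛-assoc f g h n = begin
  sumTo n (λ i → (f ⊛ g) i *ℤ h (n ∸ i))
    ≡⟨ sumTo-cong n (λ i _ → sym (sumTo-*ʳ i (h (n ∸ i)) (λ j → f j *ℤ g (i ∸ j)))) ⟩
  sumTo n (λ i → sumTo i (λ j → f j *ℤ g (i ∸ j) *ℤ h (n ∸ i)))
    ≡⟨ sumTo-exchange n (λ i j → f j *ℤ g (i ∸ j) *ℤ h (n ∸ i)) ⟩
  sumTo n (λ j → sumTo (n ∸ j) (λ t → f j *ℤ g (j + t ∸ j) *ℤ h (n ∸ (j + t))))
    ≡⟨ sumTo-cong n (λ j _ → trans (sumTo-cong (n ∸ j) (λ t _ → reindex j t))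
                                   (sumTo-*ˡ (n ∸ j) (f j) (λ t → g t *ℤ h (n ∸ j ∸ t)))) ⟩
  sumTo n (λ j → f j *ℤ (g ⊛ h) (n ∸ j)) ∎
  where
  open ≡-Reasoning
  reindex : ∀ j t → f j *ℤ g (j + t ∸ j) *ℤ h (n ∸ (j + t)) ≡ f j *ℤ (g t *ℤ h (n ∸ j ∸ t))
  reindex j t rewrite ℕ.m+n∸m≡n j t | ℕ.∸-+-assoc n j t = ℤ.*-assoc (f j) (g t) (h (n ∸ (j + t)))

shift : ℕ → Series → Series
shift zero    F n       = F n
shift (suc m) F zero    = 0ℤ
shift (suc m) F (suc n) = shift m F n

shift-≥ : ∀ {m n} F → m ≤ n → shift m F n ≡ F (n ∸ m)
shift-≥ F z≤n       = refl
shift-≥ F (s≤s m≤n) = shift-≥ F m≤n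

shift-< : ∀ {m n} F → n < m → shift m F n ≡ 0ℤ
shift-< {suc m} {zero}  F _         = refl
shift-< {suc m} {suc n} F (s≤s n<m) = shift-< F n<m

shift-cong : ∀ m {F G} → F ≗ G → shift m F ≗ shift m G
shift-cong zero    F≗G n       = F≗G n
shift-cong (suc m) F≗G zero    = refl
shift-cong (suc m) F≗G (suc n) = shift-cong m F≗G n

shift-+ : ∀ m F G n → shift m (λ i → F i +ℤ G i) n ≡ shift m F n +ℤ shift m G n
shift-+ zero    F G n       = refl
shift-+ (suc m) F G zero    = refl
shift-+ (suc m) F G (suc n) = shift-+ m F G n

qPow-⊛ : ∀ m F → qPow m ⊛ F ≗ shift m F
qPow-⊛ zero    F zero    = ℤ.*-identityˡ (F 0)
qPow-⊛ zero    F (suc n) = begin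
  sumTo (suc n) (λ i → qPow 0 i *ℤ F (suc n ∸ i))
    ≡⟨ sumTo-suc n _ ⟩
  1ℤ *ℤ F (suc n) +ℤ sumTo n (λ i → 0ℤ *ℤ F (n ∸ i))
    ≡⟨ cong₂ _+ℤ_ (ℤ.*-identityˡ (F (suc n))) (sumTo-0 n _ (λ i → ℤ.*-zeroˡ (F (n ∸ i)))) ⟩
  F (suc n) +ℤ 0ℤ
    ≡⟨ ℤ.+-identityʳ (F (suc n)) ⟩
  F (suc n) ∎
  where open ≡-Reasoning
qPow-⊛ (suc m) F zero    = ℤ.*-zeroˡ (F 0)
qPow-⊛ (suc m) F (suc n) = begin
  sumTo (suc n) (λ i → qPow (suc m) i *ℤ F (suc n ∸ i))
    ≡⟨ sumTo-suc n _ ⟩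
  0ℤ *ℤ F (suc n) +ℤ (qPow m ⊛ F) n
    ≡⟨ cong (_+ℤ (qPow m ⊛ F) n) (ℤ.*-zeroˡ (F (suc n))) ⟩
  0ℤ +ℤ (qPow m ⊛ F) n
    ≡⟨ ℤ.+-identityˡ _ ⟩
  (qPow m ⊛ F) n
    ≡⟨ qPow-⊛ m F n ⟩
  shift m F n ∎
  where open ≡-Reasoning

oneS≗qPow0 : oneS ≗ qPow 0
oneS≗qPow0 zero    = refl
oneS≗qPow0 (suc n) = refl

⊛-identityˡ : ∀ F → oneS ⊛ F ≗ F
⊛-identityˡ F n = trans (⊛-congˡ F oneS≗qPow0 n) (qPow-⊛ 0 F n)

⊛-identityʳ : ∀ F → F ⊛ oneS ≗ F
⊛-identityʳ F n = trans (⊛-comm F oneS n) (⊛-identityˡ F n)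

⊛-commutativeMonoid : CommutativeMonoid 0ℓ 0ℓ
⊛-commutativeMonoid = record
  { Carrier             = Series
  ; _≈_                 = _≗_
  ; _∙_                 = _⊛_
  ; ε                   = oneS
  ; isCommutativeMonoid = record
    { isMonoid = record
      { isSemigroup = record
        { isMagma  = record
          { isEquivalence = Setoid.isEquivalence (ℕ →-setoid ℤ)
          ; ∙-cong        = ⊛-cong
          }
        ; assoc    = ⊛-assoc
        }
      ; identity = ⊛-identityˡ , ⊛-identityʳ
      }
    ; comm     = ⊛-comm
    }
  }

open import Algebra.Properties.CommutativeSemigroup (CommutativeMonoid.commutativeSemigroup ⊛-commutativeMonoid)
  using (x∙yz≈y∙xz; x∙yz≈xz∙y; x∙yz≈yx∙z; xy∙z≈y∙xz)
module ≗-Reasoning = Relation.Binary.Reasoning.Setoid (CommutativeMonoid.setoid ⊛-commutativeMonoid)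

qPow-+ : ∀ m n → qPow m ⊛ qPow n ≗ qPow (m + n)
qPow-+ m n i = trans (qPow-⊛ m (qPow n) i) (shift-qPow m i)
  where
  shift-qPow : ∀ m i → shift m (qPow n) i ≡ qPow (m + n) i
  shift-qPow zero    i       = refl
  shift-qPow (suc m) zero    = refl
  shift-qPow (suc m) (suc i) = shift-qPow m i

⊛-oneMinusQ : ∀ m F n → (F ⊛ oneMinusQ m) n ≡ F n -ℤ shift m F n
⊛-oneMinusQ m F n = begin
  (F ⊛ oneMinusQ m) n
    ≡⟨ ⊛-comm F (oneMinusQ m) n ⟩
  sumTo n (λ i → (oneS i -ℤ qPow m i) *ℤ F (n ∸ i))
    ≡⟨ sumTo-cong n (λ i _ → *-distribʳ-minus (oneS i) (qPow m i) (F (n ∸ i))) ⟩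
  sumTo n (λ i → oneS i *ℤ F (n ∸ i) -ℤ qPow m i *ℤ F (n ∸ i))
    ≡⟨ sumTo-minus n _ _ ⟩
  (oneS ⊛ F) n -ℤ (qPow m ⊛ F) n
    ≡⟨ cong₂ _-ℤ_ (⊛-identityˡ F n) (qPow-⊛ m F n) ⟩
  F n -ℤ shift m F n ∎
  where
  open ≡-Reasoning
  *-distribʳ-minus : ∀ a b c → (a -ℤ b) *ℤ c ≡ a *ℤ c -ℤ b *ℤ c
  *-distribʳ-minus = solve-∀

recurrence⇒⊛-oneMinusQ : ∀ m F H → (∀ n → F n ≡ H n +ℤ shift m F n) → F ⊛ oneMinusQ m ≗ H
recurrence⇒⊛-oneMinusQ m F H F≡H+qᵐF n = begin
  (F ⊛ oneMinusQ m) n              ≡⟨ ⊛-oneMinusQ m F n ⟩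
  F n -ℤ shift m F n               ≡⟨ cong (_-ℤ shift m F n) (F≡H+qᵐF n) ⟩
  H n +ℤ shift m F n -ℤ shift m F n ≡⟨ i+j-j≡i (H n) (shift m F n) ⟩
  H n ∎
  where
  open ≡-Reasoning
  i+j-j≡i : ∀ a b → a +ℤ b -ℤ b ≡ a
  i+j-j≡i = solve-∀

finPoch-suc : ∀ {i t} → i ≤ t → finPoch (suc t) i ≡ finPoch t i
finPoch-suc {i} {t} i≤t = begin
  finPoch (suc t) i                           ≡⟨ ⊛-oneMinusQ (suc t) (finPoch t) i ⟩
  finPoch t i -ℤ shift (suc t) (finPoch t) i  ≡⟨ cong (finPoch t i -ℤ_) (shift-< (finPoch t) (s≤s i≤t)) ⟩
  finPoch t i +ℤ 0ℤ                           ≡⟨ ℤ.+-identityʳ (finPoch t i) ⟩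
  finPoch t i                                 ∎
  where open ≡-Reasoning

finPoch-stable : ∀ {i t} → i ≤′ t → finPoch t i ≡ qPochInf i
finPoch-stable ≤′-refl         = refl
finPoch-stable (≤′-step i≤′t) = trans (finPoch-suc (ℕ.≤′⇒≤ i≤′t)) (finPoch-stable i≤′t)

qPochInf≗[_]finPoch : ∀ n {t} → n ≤ t → qPochInf ≗[ n ] finPoch t
qPochInf≗[ n ]finPoch n≤t i i≤n = sym (finPoch-stable (ℕ.≤⇒≤′ (ℕ.≤-trans i≤n n≤t)))

-- Partitions with bounded parts

ps-suc-≤ : ∀ f {m n} → m ≤ n →
  ps (suc f) (suc m) (suc n) ≡ map (suc m ∷_) (ps f (suc m) (n ∸ m)) ++ ps (suc f) m (suc n)
ps-suc-≤ f m≤n rewrite ℕ.m≤n⇒m⊓n≡m m≤n | ℕ.m≤n⇒m⊓n≡m (ℕ.m≤n⇒m≤1+n m≤n) = refl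

ps-suc-> : ∀ f {m n} → n < m → ps (suc f) (suc m) (suc n) ≡ ps (suc f) m (suc n)
ps-suc-> f n<m rewrite ℕ.m≥n⇒m⊓n≡n (ℕ.<⇒≤ n<m) | ℕ.m≥n⇒m⊓n≡n n<m = refl

ps-fuel : ∀ f f′ m n → n ≤ f → n ≤ f′ → ps f m n ≡ ps f′ m n
ps-fuel _       _        _       zero    _         _          = refl
ps-fuel (suc f) (suc f′) zero    (suc n) _         _          = refl
ps-fuel (suc f) (suc f′) (suc m) (suc n) (s≤s n≤f) (s≤s n≤f′) with ℕ.≤-<-connex m n
... | inj₁ m≤n = begin
  ps (suc f) (suc m) (suc n)
    ≡⟨ ps-suc-≤ f m≤n ⟩
  map (suc m ∷_) (ps f (suc m) (n ∸ m)) ++ ps (suc f) m (suc n)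
    ≡⟨ cong₂ _++_ (cong (map (suc m ∷_)) (ps-fuel f f′ (suc m) (n ∸ m) (n∸m≤ n≤f) (n∸m≤ n≤f′)))
                  (ps-fuel (suc f) (suc f′) m (suc n) (s≤s n≤f) (s≤s n≤f′)) ⟩
  map (suc m ∷_) (ps f′ (suc m) (n ∸ m)) ++ ps (suc f′) m (suc n)
    ≡⟨ ps-suc-≤ f′ m≤n ⟨
  ps (suc f′) (suc m) (suc n) ∎
  where
  open ≡-Reasoning
  n∸m≤ : ∀ {g} → n ≤ g → n ∸ m ≤ g
  n∸m≤ = ℕ.≤-trans (ℕ.m∸n≤m n m)
... | inj₂ n<m = begin
  ps (suc f) (suc m) (suc n)   ≡⟨ ps-suc-> f n<m ⟩
  ps (suc f) m (suc n)         ≡⟨ ps-fuel (suc f) (suc f′) m (suc n) (s≤s n≤f) (s≤s n≤f′) ⟩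
  ps (suc f′) m (suc n)        ≡⟨ ps-suc-> f′ n<m ⟨
  ps (suc f′) (suc m) (suc n)  ∎
  where open ≡-Reasoning

ps-saturated : ∀ f {m n} → n ≤ m → ps f m n ≡ ps f n n
ps-saturated f       {n = zero}  _   = refl
ps-saturated zero    {n = suc n} _   = refl
ps-saturated (suc f) {n = suc n} n≤m rewrite ℕ.m≥n⇒m⊓n≡n n≤m | ℕ.⊓-idem n = refl

ps-parts≤ : ∀ f m n → All (All (_≤ m)) (ps f m n)
ps-parts≤ _       _       zero    = [] ∷ []
ps-parts≤ zero    _       (suc n) = []
ps-parts≤ (suc f) zero    (suc n) = []
ps-parts≤ (suc f) (suc m) (suc n) with ℕ.≤-<-connex m n
... | inj₁ m≤n rewrite ps-suc-≤ f m≤n =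
  ++⁺ (map⁺ (All.map (ℕ.≤-refl ∷_) (ps-parts≤ f (suc m) (n ∸ m))))
      (All.map (All.map ℕ.m≤n⇒m≤1+n) (ps-parts≤ (suc f) m (suc n)))
... | inj₂ n<m rewrite ps-suc-> f n<m =
  All.map (All.map ℕ.m≤n⇒m≤1+n) (ps-parts≤ (suc f) m (suc n))

sum-map-+ : ∀ {A : Set} (v w : A → ℕ) xs →
  listSum (map (λ x → v x + w x) xs) ≡ listSum (map v xs) + listSum (map w xs)
sum-map-+ v w []       = refl
sum-map-+ v w (x ∷ xs) = trans (cong (λ s → v x + w x + s) (sum-map-+ v w xs)) (interchange (v x) (w x) _ _)
  where open import Algebra.Properties.CommutativeSemigroup ℕ.+-commutativeSemigroup using (interchange)

sum-map-0 : ∀ {A : Set} (w : A → ℕ) {xs} → All (λ x → w x ≡ 0) xs → listSum (map w xs) ≡ 0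
sum-map-0 w []           = refl
sum-map-0 w (wx≡0 ∷ w≡0) = cong₂ _+_ wx≡0 (sum-map-0 w w≡0)

sum-map-filter : ∀ {A : Set} {P : Pred A 0ℓ} (P? : Decidable P) (w : A → ℕ) →
  (∀ x → ¬ P x → w x ≡ 0) → ∀ xs → listSum (map w (filter P? xs)) ≡ listSum (map w xs)
sum-map-filter P? w w≡0 []       = refl
sum-map-filter P? w w≡0 (x ∷ xs) with P? x
... | yes _   = cong (λ s → w x + s) (sum-map-filter P? w w≡0 xs)
... | no ¬px = trans (sum-map-filter P? w w≡0 xs) (cong (_+ listSum (map w xs)) (sym (w≡0 x ¬px)))

sum-ps-suc-≤ : ∀ w {m n} → m ≤ n →
  listSum (map w (ps (suc n) (suc m) (suc n)))
    ≡ listSum (map (w ∘ (suc m ∷_)) (ps (n ∸ m) (suc m) (n ∸ m))) + listSum (map w (ps (suc n) m (suc n)))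
sum-ps-suc-≤ w {m} {n} m≤n = begin
  listSum (map w (ps (suc n) (suc m) (suc n)))
    ≡⟨ cong (listSum ∘ map w) (ps-suc-≤ n m≤n) ⟩
  listSum (map w (map (suc m ∷_) largest ++ rest))
    ≡⟨ cong listSum (List.map-++ w (map (suc m ∷_) largest) rest) ⟩
  listSum (map w (map (suc m ∷_) largest) ++ map w rest)
    ≡⟨ sum-++ (map w (map (suc m ∷_) largest)) (map w rest) ⟩
  listSum (map w (map (suc m ∷_) largest)) + listSum (map w rest)
    ≡⟨ cong (λ xs → listSum xs + listSum (map w rest)) (List.map-∘ largest) ⟨
  listSum (map (w ∘ (suc m ∷_)) largest) + listSum (map w rest)
    ≡⟨ cong (λ xs → listSum (map (w ∘ (suc m ∷_)) xs) + listSum (map w rest))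
            (ps-fuel n (n ∸ m) (suc m) (n ∸ m) (ℕ.m∸n≤m n m) ℕ.≤-refl) ⟩
  listSum (map (w ∘ (suc m ∷_)) (ps (n ∸ m) (suc m) (n ∸ m))) + listSum (map w rest) ∎
  where
  open ≡-Reasoning
  largest rest : List (List ℕ)
  largest = ps n (suc m) (n ∸ m)
  rest    = ps (suc n) m (suc n)

partitionSeries : (List ℕ → ℕ) → ℕ → Series
partitionSeries w m n = + listSum (map w (ps n m n))

partitionSeries-cong : ∀ {v w} m → (∀ l → v l ≡ w l) → partitionSeries v m ≗ partitionSeries w m
partitionSeries-cong m v≗w n = cong (λ xs → + listSum xs) (List.map-cong v≗w (ps n m n))

partitionSeries-+ : ∀ v w m n →
  partitionSeries (λ l → v l + w l) m n ≡ partitionSeries v m n +ℤ partitionSeries w m n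
partitionSeries-+ v w m n =
  trans (cong +_ (sum-map-+ v w (ps n m n))) (ℤ.pos-+ (listSum (map v (ps n m n))) (listSum (map w (ps n m n))))

partitionSeries-saturated : ∀ w {m n} → n ≤ m → partitionSeries w m n ≡ + listSum (map w (partitions n))
partitionSeries-saturated w {n = n} n≤m = cong (λ xs → + listSum (map w xs)) (ps-saturated n n≤m)

partitionSeries-vanishes : ∀ w m → (∀ l → All (_≤ m) l → w l ≡ 0) → ∀ n → partitionSeries w m n ≡ 0ℤ
partitionSeries-vanishes w m w≡0 n = cong +_ (sum-map-0 w (All.map (w≡0 _) (ps-parts≤ n m n)))

partitionSeries-suc : ∀ w m n →
  partitionSeries w (suc m) n
    ≡ partitionSeries w m n +ℤ shift (suc m) (partitionSeries (w ∘ (suc m ∷_)) (suc m)) n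
partitionSeries-suc w m zero    = sym (ℤ.+-identityʳ (partitionSeries w m 0))
partitionSeries-suc w m (suc n) with ℕ.≤-<-connex m n
... | inj₁ m≤n = begin
  partitionSeries w (suc m) (suc n)
    ≡⟨ cong +_ (sum-ps-suc-≤ w m≤n) ⟩
  + (listSum (map (w ∘ (suc m ∷_)) (ps (n ∸ m) (suc m) (n ∸ m))) + listSum (map w (ps (suc n) m (suc n))))
    ≡⟨ ℤ.pos-+ (listSum (map (w ∘ (suc m ∷_)) (ps (n ∸ m) (suc m) (n ∸ m))))
               (listSum (map w (ps (suc n) m (suc n)))) ⟩
  partitionSeries (w ∘ (suc m ∷_)) (suc m) (n ∸ m) +ℤ partitionSeries w m (suc n)
    ≡⟨ ℤ.+-comm (partitionSeries (w ∘ (suc m ∷_)) (suc m) (n ∸ m)) (partitionSeries w m (suc n)) ⟩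
  partitionSeries w m (suc n) +ℤ partitionSeries (w ∘ (suc m ∷_)) (suc m) (n ∸ m)
    ≡⟨ cong (partitionSeries w m (suc n) +ℤ_)
            (shift-≥ (partitionSeries (w ∘ (suc m ∷_)) (suc m)) (s≤s m≤n)) ⟨
  partitionSeries w m (suc n) +ℤ shift (suc m) (partitionSeries (w ∘ (suc m ∷_)) (suc m)) (suc n) ∎
  where open ≡-Reasoning
... | inj₂ n<m = begin
  partitionSeries w (suc m) (suc n)
    ≡⟨ cong (λ xs → + listSum (map w xs)) (ps-suc-> n n<m) ⟩
  partitionSeries w m (suc n)
    ≡⟨ ℤ.+-identityʳ (partitionSeries w m (suc n)) ⟨
  partitionSeries w m (suc n) +ℤ 0ℤ
    ≡⟨ cong (partitionSeries w m (suc n) +ℤ_)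
            (shift-< (partitionSeries (w ∘ (suc m ∷_)) (suc m)) (s≤s n<m)) ⟨
  partitionSeries w m (suc n) +ℤ shift (suc m) (partitionSeries (w ∘ (suc m ∷_)) (suc m)) (suc n) ∎
  where open ≡-Reasoning

partitionSeries-suc-⊛-oneMinusQ : ∀ w m → (∀ l → w (suc m ∷ l) ≡ w l) →
  partitionSeries w (suc m) ⊛ oneMinusQ (suc m) ≗ partitionSeries w m
partitionSeries-suc-⊛-oneMinusQ w m w-inv = recurrence⇒⊛-oneMinusQ (suc m) _ _ λ n →
  trans (partitionSeries-suc w m n)
        (cong (partitionSeries w m n +ℤ_) (shift-cong (suc m) (partitionSeries-cong (suc m) w-inv) n))

partitionSeries-suc-⊛-oneMinusQ-split : ∀ w w₁ m →
  (∀ l → w (suc m ∷ l) ≡ w₁ l + w l) → (∀ n → partitionSeries w m n ≡ 0ℤ) →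
  partitionSeries w (suc m) ⊛ oneMinusQ (suc m) ≗ qPow (suc m) ⊛ partitionSeries w₁ (suc m)
partitionSeries-suc-⊛-oneMinusQ-split w w₁ m w-split wₘ≡0 n = begin
  (F ⊛ oneMinusQ (suc m)) n      ≡⟨ recurrence⇒⊛-oneMinusQ (suc m) F (shift (suc m) F₁) F≡qF₁+qF n ⟩
  shift (suc m) F₁ n             ≡⟨ qPow-⊛ (suc m) F₁ n ⟨
  (qPow (suc m) ⊛ F₁) n          ∎
  where
  open ≡-Reasoning
  F F₁ : Series
  F  = partitionSeries w (suc m)
  F₁ = partitionSeries w₁ (suc m)
  F≡qF₁+qF : ∀ n → F n ≡ shift (suc m) F₁ n +ℤ shift (suc m) F n
  F≡qF₁+qF n = begin
    F n
      ≡⟨ partitionSeries-suc w m n ⟩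
    partitionSeries w m n +ℤ shift (suc m) (partitionSeries (w ∘ (suc m ∷_)) (suc m)) n
      ≡⟨ cong₂ _+ℤ_ (wₘ≡0 n) (shift-cong (suc m) (partitionSeries-cong (suc m) w-split) n) ⟩
    0ℤ +ℤ shift (suc m) (partitionSeries (λ l → w₁ l + w l) (suc m)) n
      ≡⟨ ℤ.+-identityˡ _ ⟩
    shift (suc m) (partitionSeries (λ l → w₁ l + w l) (suc m)) n
      ≡⟨ shift-cong (suc m) (partitionSeries-+ w₁ w (suc m)) n ⟩
    shift (suc m) (λ i → F₁ i +ℤ F i) n
      ≡⟨ shift-+ (suc m) F₁ F n ⟩
    shift (suc m) F₁ n +ℤ shift (suc m) F n ∎

clearedSeries : (List ℕ → ℕ) → ℕ → Series
clearedSeries w m = partitionSeries w m ⊛ finPoch m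

clearedSeries-suc : ∀ w m → (∀ l → w (suc m ∷ l) ≡ w l) → clearedSeries w (suc m) ≗ clearedSeries w m
clearedSeries-suc w m w-inv = begin
  partitionSeries w (suc m) ⊛ (finPoch m ⊛ oneMinusQ (suc m))
    ≈⟨ x∙yz≈xz∙y (partitionSeries w (suc m)) (finPoch m) (oneMinusQ (suc m)) ⟩
  (partitionSeries w (suc m) ⊛ oneMinusQ (suc m)) ⊛ finPoch m
    ≈⟨ ⊛-congˡ (finPoch m) (partitionSeries-suc-⊛-oneMinusQ w m w-inv) ⟩
  partitionSeries w m ⊛ finPoch m ∎
  where open ≗-Reasoning

clearedSeries-stable : ∀ w {m t} → (∀ j → m < j → ∀ l → w (j ∷ l) ≡ w l) → m ≤′ t →
  clearedSeries w t ≗ clearedSeries w m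
clearedSeries-stable w w-inv ≤′-refl            n = refl
clearedSeries-stable w w-inv (≤′-step {t} m≤′t) n =
  trans (clearedSeries-suc w t (w-inv (suc t) (s≤s (ℕ.≤′⇒≤ m≤′t))) n) (clearedSeries-stable w w-inv m≤′t n)

clearedSeries-split : ∀ w w₁ m →
  (∀ l → w (suc m ∷ l) ≡ w₁ l + w l) → (∀ n → partitionSeries w m n ≡ 0ℤ) →
  oneMinusQ (suc m) ⊛ clearedSeries w (suc m) ≗ qPow (suc m) ⊛ clearedSeries w₁ (suc m)
clearedSeries-split w w₁ m w-split wₘ≡0 = begin
  oneMinusQ (suc m) ⊛ (partitionSeries w (suc m) ⊛ finPoch (suc m))
    ≈⟨ x∙yz≈yx∙z (oneMinusQ (suc m)) (partitionSeries w (suc m)) (finPoch (suc m)) ⟩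
  (partitionSeries w (suc m) ⊛ oneMinusQ (suc m)) ⊛ finPoch (suc m)
    ≈⟨ ⊛-congˡ (finPoch (suc m)) (partitionSeries-suc-⊛-oneMinusQ-split w w₁ m w-split wₘ≡0) ⟩
  (qPow (suc m) ⊛ partitionSeries w₁ (suc m)) ⊛ finPoch (suc m)
    ≈⟨ ⊛-assoc (qPow (suc m)) (partitionSeries w₁ (suc m)) (finPoch (suc m)) ⟩
  qPow (suc m) ⊛ (partitionSeries w₁ (suc m) ⊛ finPoch (suc m)) ∎
  where
  open ≗-Reasoning

-- Multiplicities in pre_k

mult-++ : ∀ xs ys i → mult (xs ++ ys) i ≡ mult xs i + mult ys i
mult-++ xs ys i = trans (cong length (List.filter-++ (_≟ i) xs ys)) (List.length-++ (filter (_≟ i) xs))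

mult-≡0 : ∀ {ν i} → All (_≢ i) ν → mult ν i ≡ 0
mult-≡0 {i = i} ν≢i = cong length (List.filter-none (_≟ i) ν≢i)

mult-map-injective : ∀ {f : ℕ → ℕ} → (∀ {x y} → f x ≡ f y → x ≡ y) → ∀ ν i → mult (map f ν) (f i) ≡ mult ν i
mult-map-injective         inj []      i = refl
mult-map-injective {f = f} inj (y ∷ ν) i with y ≟ i
... | yes y≡i = trans (cong length (List.filter-accept (_≟ f i) (cong f y≡i)))
  (trans (cong suc (mult-map-injective inj ν i)) (sym (cong length (List.filter-accept (_≟ i) y≡i))))
... | no y≢i = trans (cong length (List.filter-reject (_≟ f i) (y≢i ∘ inj)))
  (trans (mult-map-injective inj ν i) (sym (cong length (List.filter-reject (_≟ i) y≢i))))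

subsOf-All : ∀ {A : Set} {P : A → Set} k {l} → All P l → All (All P) (subsOf k l)
subsOf-All zero    _           = [] ∷ []
subsOf-All (suc k) []          = []
subsOf-All (suc k) (px ∷ pxs) = ++⁺ (map⁺ (All.map (px ∷_) (subsOf-All k pxs))) (subsOf-All (suc k) pxs)

subsOf-short : ∀ {A : Set} k (l : List A) → length l < k → subsOf k l ≡ []
subsOf-short (suc k) []      _         = refl
subsOf-short (suc k) (x ∷ l) (s≤s l<k)
  rewrite subsOf-short k l l<k | subsOf-short (suc k) l (ℕ.m<n⇒m<1+n l<k) = refl

pre-cons : ∀ k x l → pre (suc k) (x ∷ l) ≡ map (x *_) (pre k l) ++ pre (suc k) l
pre-cons k x l = trans (List.map-++ listProduct (map (x ∷_) (subsOf k l)) (subsOf (suc k) l))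
  (cong (_++ pre (suc k) l) (trans (sym (List.map-∘ (subsOf k l))) (List.map-∘ (subsOf k l))))

preCount : ℕ → ℕ → List ℕ → ℕ
preCount k i l = mult (pre k l) i

preCount-cons : ∀ k i x l → preCount (suc k) i (x ∷ l) ≡ mult (map (x *_) (pre k l)) i + preCount (suc k) i l
preCount-cons k i x l =
  trans (cong (λ ν → mult ν i) (pre-cons k x l)) (mult-++ (map (x *_) (pre k l)) (pre (suc k) l) i)

preCount-short : ∀ k i l → length l < k → preCount k i l ≡ 0
preCount-short k i l l<k = cong (λ ss → mult (map listProduct ss) i) (subsOf-short k l l<k)

preCount-cons-self : ∀ k p l .{{_ : NonZero p}} →
  preCount (suc k) p (p ∷ l) ≡ preCount k 1 l + preCount (suc k) p l
preCount-cons-self k p l = trans (preCount-cons k p p l) (cong (_+ preCount (suc k) p l) (begin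
  mult (map (p *_) (pre k l)) p        ≡⟨ cong (mult (map (p *_) (pre k l))) (ℕ.*-identityʳ p) ⟨
  mult (map (p *_) (pre k l)) (p * 1)  ≡⟨ mult-map-injective (ℕ.*-cancelˡ-≡ _ _ p) (pre k l) 1 ⟩
  preCount k 1 l                       ∎))
  where open ≡-Reasoning

preCount-cons-other : ∀ k {p x} l → Irreducible p → x ≢ 1 → x ≢ p →
  preCount k p (x ∷ l) ≡ preCount k p l
preCount-cons-other zero    l _   _   _   = refl
preCount-cons-other (suc k) {p} {x} l irr x≢1 x≢p =
  trans (preCount-cons k p x l) (cong (_+ preCount (suc k) p l) (mult-≡0 (map⁺ (All.universal xy≢p (pre k l)))))
  where
  xy≢p : ∀ y → x * y ≢ p
  xy≢p y xy≡p = [ x≢1 , x≢p ]′ (irr (subst (x ∣_) xy≡p (m∣m*n y)))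

product-smallParts≢ : ∀ {p x xs} → Irreducible p → All (_< p) (x ∷ xs) → listProduct (x ∷ xs) ≢ p
product-smallParts≢ {x = x} irr (x<p ∷ []) x*1≡p = ℕ.<-irrefl (trans (sym (ℕ.*-identityʳ x)) x*1≡p) x<p
product-smallParts≢ {x = x} irr (x<p ∷ xs<p@(_ ∷ _)) xP≡p with irr (subst (x ∣_) xP≡p (m∣m*n _))
... | inj₁ refl = product-smallParts≢ irr xs<p (trans (sym (ℕ.*-identityˡ _)) xP≡p)
... | inj₂ x≡p  = ℕ.<-irrefl x≡p x<p

preCount-smallParts : ∀ {p} → Irreducible p → ∀ k {l} → All (_< p) l → preCount (suc k) p l ≡ 0
preCount-smallParts         irr k []           = refl
preCount-smallParts {p} irr k {x ∷ l} (x<p ∷ l<p) = trans (preCount-cons k p x l) (cong₂ _+_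
  (mult-≡0 (map⁺ (map⁺ (All.map (λ s<p → product-smallParts≢ irr (x<p ∷ s<p)) (subsOf-All k l<p)))))
  (preCount-smallParts irr k l<p))

-- The generating function

partitionSeries-preCount-0-1 : partitionSeries (preCount 0 1) 0 ≗ oneS
partitionSeries-preCount-0-1 zero    = refl
partitionSeries-preCount-0-1 (suc n) = refl

clearedSeries-preCount-split : ∀ k m → Irreducible (suc m) →
  oneMinusQ (suc m) ⊛ clearedSeries (preCount (suc k) (suc m)) (suc m)
    ≗ qPow (suc m) ⊛ clearedSeries (preCount k 1) (suc m)
clearedSeries-preCount-split k m irr =
  clearedSeries-split (preCount (suc k) (suc m)) (preCount k 1) m (λ l → preCount-cons-self k (suc m) l)
    (partitionSeries-vanishes (preCount (suc k) (suc m)) m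
      (λ l l≤m → preCount-smallParts irr k (All.map s≤s l≤m)))

clearedSeries-preCount-stable : ∀ k {p m t} → Irreducible p → 1 ≤ m → p ≤ m → m ≤ t →
  clearedSeries (preCount k p) t ≗ clearedSeries (preCount k p) m
clearedSeries-preCount-stable k {p} {m} irr 1≤m p≤m m≤t =
  clearedSeries-stable (preCount k p) large-ignored (ℕ.≤⇒≤′ m≤t)
  where
  large-ignored : ∀ j → m < j → ∀ l → preCount k p (j ∷ l) ≡ preCount k p l
  large-ignored j m<j l =
    preCount-cons-other k l irr (ℕ.>⇒≢ (ℕ.≤-<-trans 1≤m m<j)) (ℕ.>⇒≢ (ℕ.≤-<-trans p≤m m<j))

clearedSeries-preCount-one : ∀ k → (oneMinusQ 1 ^S k) ⊛ clearedSeries (preCount k 1) 1 ≗ qPow k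
clearedSeries-preCount-one zero = begin
  oneS ⊛ clearedSeries (preCount 0 1) 1           ≈⟨ ⊛-identityˡ _ ⟩
  clearedSeries (preCount 0 1) 1                  ≈⟨ clearedSeries-suc (preCount 0 1) 0 (λ _ → refl) ⟩
  partitionSeries (preCount 0 1) 0 ⊛ oneS         ≈⟨ ⊛-identityʳ _ ⟩
  partitionSeries (preCount 0 1) 0                ≈⟨ partitionSeries-preCount-0-1 ⟩
  oneS                                            ≈⟨ oneS≗qPow0 ⟩
  qPow 0                                          ∎
  where open ≗-Reasoning
clearedSeries-preCount-one (suc k) = begin
  (oneMinusQ 1 ⊛ P) ⊛ clearedSeries (preCount (suc k) 1) 1
    ≈⟨ xy∙z≈y∙xz (oneMinusQ 1) P (clearedSeries (preCount (suc k) 1) 1) ⟩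
  P ⊛ (oneMinusQ 1 ⊛ clearedSeries (preCount (suc k) 1) 1)
    ≈⟨ ⊛-congʳ P (clearedSeries-preCount-split k 0 irreducible[1]) ⟩
  P ⊛ (qPow 1 ⊛ clearedSeries (preCount k 1) 1)
    ≈⟨ x∙yz≈y∙xz P (qPow 1) (clearedSeries (preCount k 1) 1) ⟩
  qPow 1 ⊛ (P ⊛ clearedSeries (preCount k 1) 1)
    ≈⟨ ⊛-congʳ (qPow 1) (clearedSeries-preCount-one k) ⟩
  qPow 1 ⊛ qPow k
    ≈⟨ qPow-+ 1 k ⟩
  qPow (suc k) ∎
  where
  open ≗-Reasoning
  P : Series
  P = oneMinusQ 1 ^S k

partitionSeries-preCount-generatingFunction : ∀ k m {t} → Irreducible (suc m) → suc m ≤ t →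
  partitionSeries (preCount (suc k) (suc m)) t ⊛ ((oneMinusQ 1 ^S k) ⊛ (oneMinusQ (suc m) ⊛ finPoch t))
    ≗ qPow (suc m + k)
partitionSeries-preCount-generatingFunction k m {t} irr p≤t = begin
  partitionSeries (preCount (suc k) p) t ⊛ (P ⊛ (oneMinusQ p ⊛ finPoch t))
    ≈⟨ x∙yz≈y∙xz (partitionSeries (preCount (suc k) p) t) P (oneMinusQ p ⊛ finPoch t) ⟩
  P ⊛ (partitionSeries (preCount (suc k) p) t ⊛ (oneMinusQ p ⊛ finPoch t))
    ≈⟨ ⊛-congʳ P (x∙yz≈y∙xz (partitionSeries (preCount (suc k) p) t) (oneMinusQ p) (finPoch t)) ⟩
  P ⊛ (oneMinusQ p ⊛ clearedSeries (preCount (suc k) p) t)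
    ≈⟨ ⊛-congʳ P (⊛-congʳ (oneMinusQ p) (clearedSeries-preCount-stable (suc k) irr (s≤s z≤n) ℕ.≤-refl p≤t)) ⟩
  P ⊛ (oneMinusQ p ⊛ clearedSeries (preCount (suc k) p) p)
    ≈⟨ ⊛-congʳ P (clearedSeries-preCount-split k m irr) ⟩
  P ⊛ (qPow p ⊛ clearedSeries (preCount k 1) p)
    ≈⟨ ⊛-congʳ P (⊛-congʳ (qPow p) (clearedSeries-preCount-stable k irreducible[1] ℕ.≤-refl ℕ.≤-refl (s≤s z≤n))) ⟩
  P ⊛ (qPow p ⊛ clearedSeries (preCount k 1) 1)
    ≈⟨ x∙yz≈y∙xz P (qPow p) (clearedSeries (preCount k 1) 1) ⟩
  qPow p ⊛ (P ⊛ clearedSeries (preCount k 1) 1)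
    ≈⟨ ⊛-congʳ (qPow p) (clearedSeries-preCount-one k) ⟩
  qPow p ⊛ qPow k
    ≈⟨ qPow-+ p k ⟩
  qPow (p + k) ∎
  where
  open ≗-Reasoning
  p : ℕ
  p = suc m
  P : Series
  P = oneMinusQ 1 ^S k

aSeries≗[_]partitionSeries : ∀ n i k {t} → n ≤ t → aSeries i k ≗[ n ] partitionSeries (preCount k i) t
aSeries≗[ n ]partitionSeries i k n≤t j j≤n = trans
  (cong +_ (sum-map-filter (λ l → k ≤? length l) (preCount k i)
                           (λ l k≰l → preCount-short k i l (ℕ.≰⇒> k≰l)) (partitions j)))
  (sym (partitionSeries-saturated (preCount k i) (ℕ.≤-trans j≤n n≤t)))

aSeries-generatingFunction : ∀ k m → Irreducible (suc m) → ∀ n →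
  (aSeries (suc m) (suc k) ⊛ ((oneMinusQ 1 ^S k) ⊛ (oneMinusQ (suc m) ⊛ qPochInf))) n ≡ qPow (suc m + k) n
aSeries-generatingFunction k m irr n = begin
  (aSeries (suc m) (suc k) ⊛ (P ⊛ (oneMinusQ (suc m) ⊛ qPochInf))) n
    ≡⟨ ⊛-cong-≤ (aSeries≗[ n ]partitionSeries (suc m) (suc k) n≤t) factors≗ n ℕ.≤-refl ⟩
  (partitionSeries (preCount (suc k) (suc m)) t ⊛ (P ⊛ (oneMinusQ (suc m) ⊛ finPoch t))) n
    ≡⟨ partitionSeries-preCount-generatingFunction k m irr (ℕ.m≤n+m (suc m) n) n ⟩
  qPow (suc m + k) n ∎
  where
  open ≡-Reasoning
  t : ℕ
  t = n + suc m
  n≤t : n ≤ t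
  n≤t = ℕ.m≤m+n n (suc m)
  P : Series
  P = oneMinusQ 1 ^S k
  factors≗ : P ⊛ (oneMinusQ (suc m) ⊛ qPochInf) ≗[ n ] P ⊛ (oneMinusQ (suc m) ⊛ finPoch t)
  factors≗ = ⊛-cong-≤ {f = P} (λ _ _ → refl)
               (⊛-cong-≤ {f = oneMinusQ (suc m)} (λ _ _ → refl) (qPochInf≗[ n ]finPoch n≤t))

≡1⊎prime⇒irreducible : ∀ {p} → p ≡ 1 ⊎ Prime p → Irreducible p
≡1⊎prime⇒irreducible = [ (λ { refl → irreducible[1] }) , prime⇒irreducible ]′

corollary3p2 : (k p : ℕ) → 1 ≤ k → (p ≡ 1 ⊎ Prime p) →
    ∀ n → (aSeries p k ⊛ ((oneMinusQ 1 ^S (k ∸ 1)) ⊛ (oneMinusQ p ⊛ qPochInf))) n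
          ≡ qPow (p + k ∸ 1) n
corollary3p2 (suc k) zero    _ p≡1⊎prime n = ⊥-elim (¬irreducible[0] (≡1⊎prime⇒irreducible p≡1⊎prime))
corollary3p2 (suc k) (suc m) _ p≡1⊎prime n =
  trans (aSeries-generatingFunction k m (≡1⊎prime⇒irreducible p≡1⊎prime) n)
        (cong (λ e → qPow e n) (sym (ℕ.+-suc m k)))
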